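{- (1) The dynamic entailment relation $\vdash$ of transition algebra is $\omega_1$-compact: for every signature $\Sigma$, every set $\Gamma$ of $\Sigma$-sentences and every $\Sigma$-sentence $\phi$, if $\Gamma\vdash_\Sigma\phi$ then $\Gamma_0\vdash_\Sigma\phi$ for some at most countable $\Gamma_0\subseteq\Gamma$. (2) The satisfaction-based entailment $\models$ is not $\omega_1$-compact: there exist a signature $\Sigma$, a set $\Gamma$ of $\Sigma$-sentences and a $\Sigma$-sentence $\phi$ with $\Gamma\models_\Sigma\phi$ but $\Gamma_0\not\models_\Sigma\phi$ for every at most countable $\Gamma_0\subseteq\Gamma$.
   Context: Transition algebra (TA). A signature $\Sigma=(S,F\supseteq M,L)$ consists of a set $S$ of sorts, a family $F=\{F_{w,s}\}_{w\in S^*,s\in S}$ of sets of function symbols, a subfamily $M\subseteq F$ of monotonic function symbols, and a set $L$ of transition labels. A signature morphism $\chi\colon\Sigma\to\Sigma'$ is a many-sorted algebraic signature morphism with $\chi(M)\subseteq M'$ plus a map $L\to L'$. A $\Sigma$-model $\mathfrak A$ is a many-sorted $(S,F)$-algebra (carriers may be empty) with relations $\lambda^{\mathfrak A}_s\subseteq\mathfrak A_s\times\mathfrak A_s$ for $\lambda\in L$, $s\in S$, such that each $\sigma\in M$ is monotone in every argument w.r.t. every $\lambda$ (if $(a_k,b)\in\lambda^{\mathfrak A}$ then $(\sigma^{\mathfrak A}(\dots,a_k,\dots),\sigma^{\mathfrak A}(\dots,b,\dots))\in\lambda^{\mathfrak A}$). For a finite set $X$ of variables, $\Sigma[X]$ adds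 them as new constants. Actions: $\mathfrak a::=\lambda\mid\mathfrak a\mathbin{;}\mathfrak a\mid\mathfrak a\cup\mathfrak a\mid\mathfrak a^*$, interpreted by $\lambda^{\mathfrak A}$, relational composition, union and reflexive–transitive closure; $\mathfrak a^n$ is the $n$-fold composition of $\mathfrak a$ (for $n=0$, $t_1\stackrel{\mathfrak a^0}\Rightarrow t_2$ is read as $t_1=t_2$). $\Sigma$-sentences: $\phi::=t_1=t_2\mid t_1\stackrel{\mathfrak a}\Rightarrow t_2\mid\neg\phi\mid\bigvee\Phi\mid\exists X\,\phi'$ ($t_i$ ground terms of equal sort, $\Phi$ finite, $\phi'\in\mathrm{Sen}(\Sigma[X])$); $\bot:=\bigvee\emptyset$. Satisfaction: $\mathfrak A\models t_1=t_2$ iff $t_1^{\mathfrak A}=t_2^{\mathfrak A}$; $\mathfrak A\models t_1\stackrel{\mathfrak a}\Rightarrow t_2$ iff $(t_1^{\mathfrak A},t_2^{\mathfrak A})\in\mathfrak a^{\mathfrak A}$; $\neg,\bigvee$ classical; $\mathfrak A\models\exists X\phi'$ iff some valuation of $X$ in $\mathfrak A$ makes $\phi'$ true. $\Gamma\models_\Sigma\phi$ iff every $\Sigma$-model of $\Gamma$ satisfies $\phi$. A substitution $\theta\colon X\to T_\Sigma$ (ground terms) sends $\phi'\in\mathrm{Sen}(\Sigma[X])$ to $\theta(\phi')\in\mathrm{Sen}(\Sigma)$. An entailment relation is a family $\vdash_\Sigma\subseteq\mathcal P(\mathrm{Sen}(\Sigma))^2$ closed under: Monotonicity ($\Gamma\supseteq\Phi\Rightarrow\Gamma\vdash\Phi$),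 Transitivity, Union ($\Gamma\vdash\phi$ for all $\phi\in\Phi$ gives $\Gamma\vdash\Phi$), Translation ($\Gamma\vdash_\Sigma\Phi\Rightarrow\chi(\Gamma)\vdash_{\Sigma'}\chi(\Phi)$). The dynamic entailment relation $\vdash$ is the least entailment relation closed under the following rules. Basic: (R) $\Gamma\vdash t=t$; (S) symmetry; (T) transitivity of $=$; (F) $\Gamma\vdash t_i=t_i'$ for all $i$ gives $\Gamma\vdash\sigma(\bar t)=\sigma(\bar t')$; (P) $\Gamma\vdash t_1=t_1'$, $\Gamma\vdash t_2=t_2'$, $\Gamma\vdash t_1\stackrel{\lambda}\Rightarrow t_2$ give $\Gamma\vdash t_1'\stackrel{\lambda}\Rightarrow t_2'$; (M) for $f\in M$, $\Gamma\vdash t_j\stackrel{\lambda}\Rightarrow u_j$ gives $\Gamma\vdash f(\dots,t_j,\dots)\stackrel{\lambda}\Rightarrow f(\dots,u_j,\dots)$. Actions: (Comp$_I$) $\Gamma\vdash t_1\stackrel{\mathfrak a_1}\Rightarrow t$ and $\Gamma\vdash t\stackrel{\mathfrak a_2}\Rightarrow t_2$ give $\Gamma\vdash t_1\stackrel{\mathfrak a_1;\mathfrak a_2}\Rightarrow t_2$; (Comp$_E$) $\Gamma\vdash_\Sigma t_1\stackrel{\mathfrak a_1;\mathfrak a_2}\Rightarrow t_2$ and $\Gamma\cup\{t_1\stackrel{\mathfrak a_1}\Rightarrow x,x\stackrel{\mathfrak a_2}\Rightarrow t_2\}\vdash_{\Sigma[x]}\phi$ ($x$ a new constant of the sort of $t_1$,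 $\phi\in\mathrm{Sen}(\Sigma)$) give $\Gamma\vdash_\Sigma\phi$; (Union$_I$) $\Gamma\vdash t_1\stackrel{\mathfrak a_i}\Rightarrow t_2$ ($i\in\{1,2\}$) gives $\Gamma\vdash t_1\stackrel{\mathfrak a_1\cup\mathfrak a_2}\Rightarrow t_2$; (Union$_E$) $\Gamma\vdash t_1\stackrel{\mathfrak a_1\cup\mathfrak a_2}\Rightarrow t_2$ and $\Gamma\cup\{t_1\stackrel{\mathfrak a_i}\Rightarrow t_2\}\vdash\phi$ for $i=1,2$ give $\Gamma\vdash\phi$; (Star$_I$) $\Gamma\vdash t_1\stackrel{\mathfrak a^n}\Rightarrow t_2$ for some $n$ gives $\Gamma\vdash t_1\stackrel{\mathfrak a^*}\Rightarrow t_2$; (Star$_E$) $\Gamma\vdash t_1\stackrel{\mathfrak a^*}\Rightarrow t_2$ and $\Gamma\cup\{t_1\stackrel{\mathfrak a^n}\Rightarrow t_2\}\vdash\phi$ for all $n\in\omega$ give $\Gamma\vdash\phi$. Boolean: (Neg$_D$) $\Gamma\vdash\neg\neg\phi$ gives $\Gamma\vdash\phi$; (False) $\Gamma\vdash\bot$ gives $\Gamma\vdash\phi$; (Neg$_I$) $\Gamma\cup\{\phi\}\vdash\bot$ gives $\Gamma\vdash\neg\phi$; (Neg$_E$) $\Gamma\vdash\neg\phi$ gives $\Gamma\cup\{\phi\}\vdash\bot$; (Disj$_I$) $\Gamma\vdash\phi$ with $\phi\in\Phi$ gives $\Gamma\vdash\bigvee\Phi$; (Disj$_E$) $\Gamma\vdash\bigvee\Phi$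 and $\Gamma\cup\{\phi\}\vdash\gamma$ for all $\phi\in\Phi$ give $\Gamma\vdash\gamma$. Quantifiers: (Quant$_I$) $\Gamma\cup\{\phi\}\vdash_{\Sigma[X]}\gamma$ gives $\Gamma\cup\{\exists X\phi\}\vdash_\Sigma\gamma$ (for $\Gamma,\gamma$ over $\Sigma$); (Quant$_E$) the converse; (Subst) $\Gamma\vdash_\Sigma\theta(\phi)$ for a substitution $\theta\colon X\to T_\Sigma$ gives $\Gamma\vdash_\Sigma\exists X\phi$. -}

module Defs where

open import Level using () renaming (suc to lsuc)
open import Data.Nat using (ℕ; zero; suc)
open import Data.Fin using (Fin; zero)
open import Data.List using (List; []; _∷_; map)
open import Data.List.Properties using (map-id)
open import Data.List.Membership.Propositional using (_∈_)
open import Data.List.Relation.Unary.Any using (here; there)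
open import Data.List.Relation.Unary.All as All using (All; []; _∷_)
open import Data.Maybe using (Maybe; just)
open import Data.Product using (∃; _×_; _,_)
open import Data.Sum using (_⊎_; inj₁; inj₂)
open import Data.Empty using (⊥)
open import Relation.Binary.PropositionalEquality using (_≡_; refl; sym; subst)
open import Relation.Nullary using (¬_)
open import Function using (_∘_; const; id)

record Sig : Set₁ where
  field
    Sort : Set
    Fun  : List Sort → Sort → Set
    Mono : ∀ {w s} → Fun w s → Set         -- the subfamily M ⊆ F (as a predicate)
    Lab  : Set
open Sig public

record Mor (Σ₁ Σ₂ : Sig) : Set where
  field
    sortMap : Sort Σ₁ → Sort Σ₂
    funMap  : ∀ {w s} → Fun Σ₁ w s → Fun Σ₂ (map sortMap w) (sortMap s)
    monoMap : ∀ {w s} (f : Fun Σ₁ w s) → Mono Σ₁ f → Mono Σ₂ (funMap f)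
    labMap  : Lab Σ₁ → Lab Σ₂
open Mor public

data Term (Σ : Sig) : Sort Σ → Set
data Terms (Σ : Sig) : List (Sort Σ) → Set

data Term Σ where
  app : ∀ {w s} → Fun Σ w s → Terms Σ w → Term Σ s

data Terms Σ where
  []ₜ  : Terms Σ []
  _∷ₜ_ : ∀ {s w} → Term Σ s → Terms Σ w → Terms Σ (s ∷ w)

lookupT : ∀ {Σ w s} → Terms Σ w → s ∈ w → Term Σ s
lookupT (t ∷ₜ ts) (here refl) = t
lookupT (t ∷ₜ ts) (there k)   = lookupT ts k

updateT : ∀ {Σ w s} → Terms Σ w → s ∈ w → Term Σ s → Terms Σ w
updateT (t ∷ₜ ts) (here refl) u = u ∷ₜ ts
updateT (t ∷ₜ ts) (there k)   u = t ∷ₜ updateT ts k u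

record Vars (Σ : Sig) : Set where
  constructor vars
  field
    size   : ℕ
    sortOf : Fin size → Sort Σ
open Vars public

data ExtFun (Σ : Sig) (X : Vars Σ) : List (Sort Σ) → Sort Σ → Set where
  old : ∀ {w s} → Fun Σ w s → ExtFun Σ X w s
  var : (i : Fin (size X)) → ExtFun Σ X [] (sortOf X i)

ExtMono : ∀ {Σ X w s} → ExtFun Σ X w s → Set
ExtMono {Σ} (old f) = Mono Σ f
ExtMono (var i)     = ⊥

_[_] : (Σ : Sig) → Vars Σ → Sig
Σ [ X ] = record { Sort = Sort Σ ; Fun = ExtFun Σ X ; Mono = ExtMono {Σ} {X} ; Lab = Lab Σ }

⟨_⟩ : ∀ {Σ} → Sort Σ → Vars Σ
⟨ s ⟩ = vars 1 (λ _ → s)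

newConst : ∀ {Σ} (s : Sort Σ) → Term (Σ [ ⟨ s ⟩ ]) s
newConst s = app (var zero) []ₜ

ι : ∀ {Σ} (X : Vars Σ) → Mor Σ (Σ [ X ])
ι {Σ} X = record
  { sortMap = id
  ; funMap  = λ {w} {s} f → subst (λ v → ExtFun Σ X v s) (sym (map-id w)) (old f)
  ; monoMap = λ {w} {s} f m → monoInc w f m
  ; labMap  = id }
  where
  monoInc : ∀ {s} w (f : Fun Σ w s) → Mono Σ f →
            ExtMono {Σ} {X} (subst (λ v → ExtFun Σ X v s) (sym (map-id w)) (old f))
  monoInc w f m = monoSub (sym (map-id w))
    where
    monoSub : ∀ {v} (e : w ≡ v) → ExtMono {Σ} {X} (subst (λ v → ExtFun Σ X v _) e (old f))
    monoSub refl = m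

data Act (L : Set) : Set where
  lab  : L → Act L
  _⨾_  : Act L → Act L → Act L
  _∪ₐ_ : Act L → Act L → Act L
  _⋆   : Act L → Act L

mapAct : ∀ {L L'} → (L → L') → Act L → Act L'
mapAct h (lab l)  = lab (h l)
mapAct h (a ⨾ b)  = mapAct h a ⨾ mapAct h b
mapAct h (a ∪ₐ b) = mapAct h a ∪ₐ mapAct h b
mapAct h (a ⋆)    = mapAct h a ⋆

data Sen : Sig → Set₁ where
  _≐_    : ∀ {Σ s} → Term Σ s → Term Σ s → Sen Σ
  _⇒⟨_⟩_ : ∀ {Σ s} → Term Σ s → Act (Lab Σ) → Term Σ s → Sen Σ
  ¬ₛ_    : ∀ {Σ} → Sen Σ → Sen Σ
  ⋁      : ∀ {Σ} → List (Sen Σ) → Sen Σ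
  ∃ₛ     : ∀ {Σ} (X : Vars Σ) → Sen (Σ [ X ]) → Sen Σ

⊥ₛ : ∀ {Σ} → Sen Σ
⊥ₛ = ⋁ []

-- a^(n+1) = a ⨾ (a ⨾ ( … ⨾ a))  (n+1 copies)
actPow : ∀ {L} → Act L → ℕ → Act L
actPow a zero    = a
actPow a (suc n) = a ⨾ actPow a n

powSen : ∀ {Σ s} → Term Σ s → Act (Lab Σ) → ℕ → Term Σ s → Sen Σ
powSen t₁ a zero    t₂ = t₁ ≐ t₂
powSen t₁ a (suc n) t₂ = t₁ ⇒⟨ actPow a n ⟩ t₂

-- Translation of sentences along "derived" maps, which send a function
-- symbol either to a function symbol or (for constants) to a ground term.
-- These cover signature morphisms and substitutions θ : X → T_Σ.

data SymImg (Σ₁ Σ₂ : Sig) (σ : Sort Σ₁ → Sort Σ₂) : List (Sort Σ₁) → Sort Σ₁ → Set where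
  sym' : ∀ {w s} → Fun Σ₂ (map σ w) (σ s) → SymImg Σ₁ Σ₂ σ w s
  cst  : ∀ {s} → Term Σ₂ (σ s) → SymImg Σ₁ Σ₂ σ [] s

record SMor (Σ₁ Σ₂ : Sig) : Set where
  field
    sMap   : Sort Σ₁ → Sort Σ₂
    sLab   : Lab Σ₁ → Lab Σ₂
    symMap : ∀ {w s} → Fun Σ₁ w s → SymImg Σ₁ Σ₂ sMap w s
open SMor public

toS : ∀ {Σ₁ Σ₂} → Mor Σ₁ Σ₂ → SMor Σ₁ Σ₂
toS χ = record { sMap = sortMap χ ; sLab = labMap χ ; symMap = λ f → sym' (funMap χ f) }

applyImg : ∀ {Σ₁ Σ₂ σ w s} → SymImg Σ₁ Σ₂ σ w s → Terms Σ₂ (map σ w) → Term Σ₂ (σ s)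
applyImg (sym' g) ts = app g ts
applyImg (cst t)  _  = t

trTerm  : ∀ {Σ₁ Σ₂ s} (ρ : SMor Σ₁ Σ₂) → Term Σ₁ s → Term Σ₂ (sMap ρ s)
trTerms : ∀ {Σ₁ Σ₂ w} (ρ : SMor Σ₁ Σ₂) → Terms Σ₁ w → Terms Σ₂ (map (sMap ρ) w)
trTerm ρ (app f ts) = applyImg (symMap ρ f) (trTerms ρ ts)
trTerms ρ []ₜ       = []ₜ
trTerms ρ (t ∷ₜ ts) = trTerm ρ t ∷ₜ trTerms ρ ts

wkT  : ∀ {Σ s} {Z : Vars Σ} → Term Σ s → Term (Σ [ Z ]) s
wkTs : ∀ {Σ w} {Z : Vars Σ} → Terms Σ w → Terms (Σ [ Z ]) w
wkT (app f ts) = app (old f) (wkTs ts)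
wkTs []ₜ       = []ₜ
wkTs (t ∷ₜ ts) = wkT t ∷ₜ wkTs ts

liftV : ∀ {Σ₁ Σ₂} → SMor Σ₁ Σ₂ → Vars Σ₁ → Vars Σ₂
liftV ρ X = vars (size X) (λ i → sMap ρ (sortOf X i))

liftSym : ∀ {Σ₁ Σ₂} (ρ : SMor Σ₁ Σ₂) (X : Vars Σ₁) {w s} →
          ExtFun Σ₁ X w s → SymImg (Σ₁ [ X ]) (Σ₂ [ liftV ρ X ]) (sMap ρ) w s
liftSym ρ X (old f) with symMap ρ f
... | sym' g = sym' (old g)
... | cst t  = cst (wkT t)
liftSym ρ X (var i) = sym' (var i)

lift : ∀ {Σ₁ Σ₂} (ρ : SMor Σ₁ Σ₂) (X : Vars Σ₁) → SMor (Σ₁ [ X ]) (Σ₂ [ liftV ρ X ])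
lift ρ X = record { sMap = sMap ρ ; sLab = sLab ρ ; symMap = liftSym ρ X }

trSen  : ∀ {Σ₁ Σ₂} → SMor Σ₁ Σ₂ → Sen Σ₁ → Sen Σ₂
trSens : ∀ {Σ₁ Σ₂} → SMor Σ₁ Σ₂ → List (Sen Σ₁) → List (Sen Σ₂)
trSen ρ (t ≐ u)       = trTerm ρ t ≐ trTerm ρ u
trSen ρ (t ⇒⟨ a ⟩ u)  = trTerm ρ t ⇒⟨ mapAct (sLab ρ) a ⟩ trTerm ρ u
trSen ρ (¬ₛ φ)        = ¬ₛ trSen ρ φ
trSen ρ (⋁ Φ)         = ⋁ (trSens ρ Φ)
trSen ρ (∃ₛ X φ)      = ∃ₛ (liftV ρ X) (trSen (lift ρ X) φ)
trSens ρ []       = []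
trSens ρ (φ ∷ Φ)  = trSen ρ φ ∷ trSens ρ Φ

ιₛ : ∀ {Σ} (X : Vars Σ) → SMor Σ (Σ [ X ])
ιₛ X = toS (ι X)

Subst : ∀ {Σ} → Vars Σ → Set
Subst {Σ} X = (i : Fin (size X)) → Term Σ (sortOf X i)

substSym : ∀ {Σ} {X : Vars Σ} → Subst X → ∀ {w s} → ExtFun Σ X w s → SymImg (Σ [ X ]) Σ id w s
substSym {Σ} θ {w} {s} (old f) = sym' (subst (λ v → Fun Σ v s) (sym (map-id w)) f)
substSym θ (var i) = cst (θ i)

substₛ : ∀ {Σ} {X : Vars Σ} → Subst X → SMor (Σ [ X ]) Σ
substₛ θ = record { sMap = id ; sLab = id ; symMap = substSym θ }

record Model (Σ : Sig) : Set₁ where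
  field
    car  : Sort Σ → Set
    fun  : ∀ {w s} → Fun Σ w s → All car w → car s
    rel  : Lab Σ → (s : Sort Σ) → car s → car s → Set
    mono : ∀ {w s} (f : Fun Σ w s) → Mono Σ f → (l : Lab Σ) →
           ∀ {s'} (k : s' ∈ w) (as : All car w) (b : car s') →
           rel l s' (All.lookup as k) b →
           rel l s (fun f as) (fun f (All.updateAt k (const b) as))
open Model public

evalT  : ∀ {Σ s} (A : Model Σ) → Term Σ s → car A s
evalTs : ∀ {Σ w} (A : Model Σ) → Terms Σ w → All (car A) w
evalT A (app f ts) = fun A f (evalTs A ts)
evalTs A []ₜ       = []
evalTs A (t ∷ₜ ts) = evalT A t ∷ evalTs A ts

Iter : ∀ {C : Set} → (C → C → Set) → ℕ → C → C → Set
Iter R zero    x y = x ≡ y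
Iter R (suc n) x y = ∃ λ z → R x z × Iter R n z y

⟦_⟧ₐ : ∀ {Σ} {A : Model Σ} → Act (Lab Σ) → (s : Sort Σ) → car A s → car A s → Set
⟦_⟧ₐ {A = A} (lab l) s = rel A l s
⟦_⟧ₐ {A = A} (a ⨾ b) s x y = ∃ λ z → ⟦_⟧ₐ {A = A} a s x z × ⟦_⟧ₐ {A = A} b s z y
⟦_⟧ₐ {A = A} (a ∪ₐ b) s x y = ⟦_⟧ₐ {A = A} a s x y ⊎ ⟦_⟧ₐ {A = A} b s x y
⟦_⟧ₐ {A = A} (a ⋆) s x y = ∃ λ n → Iter (⟦_⟧ₐ {A = A} a s) n x y

module _ {Σ : Sig} (A : Model Σ) (X : Vars Σ) (v : (i : Fin (size X)) → car A (sortOf X i)) where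
  expFun : ∀ {w s} → ExtFun Σ X w s → All (car A) w → car A s
  expFun (old f) as = fun A f as
  expFun (var i) _  = v i

  expMono : ∀ {w s} (f : ExtFun Σ X w s) → ExtMono {Σ} {X} f → (l : Lab Σ) →
            ∀ {s'} (k : s' ∈ w) (as : All (car A) w) (b : car A s') →
            rel A l s' (All.lookup as k) b →
            rel A l s (expFun f as) (expFun f (All.updateAt k (const b) as))
  expMono (old f) m = mono A f m
  expMono (var i) ()

  expand : Model (Σ [ X ])
  expand = record { car = car A ; fun = expFun ; rel = rel A ; mono = expMono }

_⊨ₛ_   : ∀ {Σ} → Model Σ → Sen Σ → Set
_⊨any_ : ∀ {Σ} → Model Σ → List (Sen Σ) → Set
A ⊨ₛ (t ≐ u)      = evalT A t ≡ evalT A u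
A ⊨ₛ (_⇒⟨_⟩_ {s = s} t a u) = ⟦_⟧ₐ {A = A} a s (evalT A t) (evalT A u)
A ⊨ₛ (¬ₛ φ)       = ¬ (A ⊨ₛ φ)
A ⊨ₛ (⋁ Φ)        = A ⊨any Φ
A ⊨ₛ (∃ₛ X φ)     = ∃ λ (v : (i : Fin (size X)) → car A (sortOf X i)) → expand A X v ⊨ₛ φ
A ⊨any []      = ⊥
A ⊨any (φ ∷ Φ) = A ⊨ₛ φ ⊎ A ⊨any Φ

SenSet : Sig → Set₂
SenSet Σ = Sen Σ → Set₁

_∪ₛ_ : ∀ {Σ} → SenSet Σ → SenSet Σ → SenSet Σ
(Γ ∪ₛ Δ) φ = Γ φ ⊎ Δ φ

｛_｝ : ∀ {Σ} → Sen Σ → SenSet Σ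
｛ φ ｝ ψ = ψ ≡ φ

_⊆ₛ_ : ∀ {Σ} → SenSet Σ → SenSet Σ → Set₁
Γ ⊆ₛ Δ = ∀ φ → Γ φ → Δ φ

_⟨$⟩_ : ∀ {Σ₁ Σ₂} → SMor Σ₁ Σ₂ → SenSet Σ₁ → SenSet Σ₂
(ρ ⟨$⟩ Γ) ψ' = ∃ λ ψ → Γ ψ × trSen ρ ψ ≡ ψ'

-- at most countable: empty or the image of ℕ
AtMostCountable : ∀ {Σ} → SenSet Σ → Set₁
AtMostCountable {Σ} Γ₀ =
  ∃ λ (e : ℕ → Maybe (Sen Σ)) →
    (∀ φ → Γ₀ φ → ∃ λ n → e n ≡ just φ) × (∀ n φ → e n ≡ just φ → Γ₀ φ)

_⊨_ : ∀ {Σ} → SenSet Σ → Sen Σ → Set₁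
_⊨_ {Σ} Γ φ = (A : Model Σ) → (∀ ψ → Γ ψ → A ⊨ₛ ψ) → A ⊨ₛ φ

data Ent : (Σ : Sig) → SenSet Σ → SenSet Σ → Set₂ where
  monotonicity : ∀ {Σ} {Γ Φ : SenSet Σ} → Φ ⊆ₛ Γ → Ent Σ Γ Φ
  transitivity : ∀ {Σ} {Γ Φ Ψ : SenSet Σ} → Ent Σ Γ Φ → Ent Σ Φ Ψ → Ent Σ Γ Ψ
  union        : ∀ {Σ} {Γ Φ : SenSet Σ} → (∀ φ → Φ φ → Ent Σ Γ ｛ φ ｝) → Ent Σ Γ Φ
  translation  : ∀ {Σ Σ'} (χ : Mor Σ Σ') {Γ Φ : SenSet Σ} →
                 Ent Σ Γ Φ → Ent Σ' (toS χ ⟨$⟩ Γ) (toS χ ⟨$⟩ Φ)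
  R : ∀ {Σ Γ s} (t : Term Σ s) → Ent Σ Γ ｛ t ≐ t ｝
  S : ∀ {Σ Γ s} {t u : Term Σ s} → Ent Σ Γ ｛ t ≐ u ｝ → Ent Σ Γ ｛ u ≐ t ｝
  T : ∀ {Σ Γ s} {t u v : Term Σ s} →
      Ent Σ Γ ｛ t ≐ u ｝ → Ent Σ Γ ｛ u ≐ v ｝ → Ent Σ Γ ｛ t ≐ v ｝
  F : ∀ {Σ Γ w s} (f : Fun Σ w s) (ts us : Terms Σ w) →
      (∀ {s'} (k : s' ∈ w) → Ent Σ Γ ｛ lookupT ts k ≐ lookupT us k ｝) →
      Ent Σ Γ ｛ app f ts ≐ app f us ｝
  P : ∀ {Σ Γ s} {t₁ t₁' t₂ t₂' : Term Σ s} {l : Lab Σ} →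
      Ent Σ Γ ｛ t₁ ≐ t₁' ｝ → Ent Σ Γ ｛ t₂ ≐ t₂' ｝ → Ent Σ Γ ｛ t₁ ⇒⟨ lab l ⟩ t₂ ｝ →
      Ent Σ Γ ｛ t₁' ⇒⟨ lab l ⟩ t₂' ｝
  M : ∀ {Σ Γ w s} (f : Fun Σ w s) → Mono Σ f → ∀ {l : Lab Σ} {s'} (k : s' ∈ w)
      (ts : Terms Σ w) (u : Term Σ s') →
      Ent Σ Γ ｛ lookupT ts k ⇒⟨ lab l ⟩ u ｝ →
      Ent Σ Γ ｛ app f ts ⇒⟨ lab l ⟩ app f (updateT ts k u) ｝
  compI : ∀ {Σ Γ s} {t₁ t t₂ : Term Σ s} {a₁ a₂ : Act (Lab Σ)} →
          Ent Σ Γ ｛ t₁ ⇒⟨ a₁ ⟩ t ｝ → Ent Σ Γ ｛ t ⇒⟨ a₂ ⟩ t₂ ｝ →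
          Ent Σ Γ ｛ t₁ ⇒⟨ a₁ ⨾ a₂ ⟩ t₂ ｝
  compE : ∀ {Σ Γ s} {t₁ t₂ : Term Σ s} {a₁ a₂ : Act (Lab Σ)} {φ : Sen Σ} →
          Ent Σ Γ ｛ t₁ ⇒⟨ a₁ ⨾ a₂ ⟩ t₂ ｝ →
          Ent (Σ [ ⟨ s ⟩ ])
              ((ιₛ ⟨ s ⟩ ⟨$⟩ Γ)
                 ∪ₛ (｛ trTerm (ιₛ ⟨ s ⟩) t₁ ⇒⟨ a₁ ⟩ newConst s ｝
                 ∪ₛ ｛ newConst s ⇒⟨ a₂ ⟩ trTerm (ιₛ ⟨ s ⟩) t₂ ｝))
              ｛ trSen (ιₛ ⟨ s ⟩) φ ｝ →
          Ent Σ Γ ｛ φ ｝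
  unionI₁ : ∀ {Σ Γ s} {t₁ t₂ : Term Σ s} {a₁ a₂ : Act (Lab Σ)} →
            Ent Σ Γ ｛ t₁ ⇒⟨ a₁ ⟩ t₂ ｝ → Ent Σ Γ ｛ t₁ ⇒⟨ a₁ ∪ₐ a₂ ⟩ t₂ ｝
  unionI₂ : ∀ {Σ Γ s} {t₁ t₂ : Term Σ s} {a₁ a₂ : Act (Lab Σ)} →
            Ent Σ Γ ｛ t₁ ⇒⟨ a₂ ⟩ t₂ ｝ → Ent Σ Γ ｛ t₁ ⇒⟨ a₁ ∪ₐ a₂ ⟩ t₂ ｝
  unionE : ∀ {Σ Γ s} {t₁ t₂ : Term Σ s} {a₁ a₂ : Act (Lab Σ)} {φ : Sen Σ} →
           Ent Σ Γ ｛ t₁ ⇒⟨ a₁ ∪ₐ a₂ ⟩ t₂ ｝ →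
           Ent Σ (Γ ∪ₛ ｛ t₁ ⇒⟨ a₁ ⟩ t₂ ｝) ｛ φ ｝ →
           Ent Σ (Γ ∪ₛ ｛ t₁ ⇒⟨ a₂ ⟩ t₂ ｝) ｛ φ ｝ →
           Ent Σ Γ ｛ φ ｝
  starI : ∀ {Σ Γ s} {t₁ t₂ : Term Σ s} {a : Act (Lab Σ)} (n : ℕ) →
          Ent Σ Γ ｛ powSen t₁ a n t₂ ｝ → Ent Σ Γ ｛ t₁ ⇒⟨ a ⋆ ⟩ t₂ ｝
  starE : ∀ {Σ Γ s} {t₁ t₂ : Term Σ s} {a : Act (Lab Σ)} {φ : Sen Σ} →
          Ent Σ Γ ｛ t₁ ⇒⟨ a ⋆ ⟩ t₂ ｝ →
          (∀ (n : ℕ) → Ent Σ (Γ ∪ₛ ｛ powSen t₁ a n t₂ ｝) ｛ φ ｝) →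
          Ent Σ Γ ｛ φ ｝
  negD  : ∀ {Σ Γ} {φ : Sen Σ} → Ent Σ Γ ｛ ¬ₛ ¬ₛ φ ｝ → Ent Σ Γ ｛ φ ｝
  false : ∀ {Σ Γ} {φ : Sen Σ} → Ent Σ Γ ｛ ⊥ₛ ｝ → Ent Σ Γ ｛ φ ｝
  negI  : ∀ {Σ Γ} {φ : Sen Σ} → Ent Σ (Γ ∪ₛ ｛ φ ｝) ｛ ⊥ₛ ｝ → Ent Σ Γ ｛ ¬ₛ φ ｝
  negE  : ∀ {Σ Γ} {φ : Sen Σ} → Ent Σ Γ ｛ ¬ₛ φ ｝ → Ent Σ (Γ ∪ₛ ｛ φ ｝) ｛ ⊥ₛ ｝
  disjI : ∀ {Σ Γ} {φ : Sen Σ} {Φ : List (Sen Σ)} → φ ∈ Φ →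
          Ent Σ Γ ｛ φ ｝ → Ent Σ Γ ｛ ⋁ Φ ｝
  disjE : ∀ {Σ Γ} {Φ : List (Sen Σ)} {γ : Sen Σ} →
          Ent Σ Γ ｛ ⋁ Φ ｝ → (∀ φ → φ ∈ Φ → Ent Σ (Γ ∪ₛ ｛ φ ｝) ｛ γ ｝) →
          Ent Σ Γ ｛ γ ｝
  quantI : ∀ {Σ Γ} (X : Vars Σ) (φ : Sen (Σ [ X ])) (γ : Sen Σ) →
           Ent (Σ [ X ]) ((ιₛ X ⟨$⟩ Γ) ∪ₛ ｛ φ ｝) ｛ trSen (ιₛ X) γ ｝ →
           Ent Σ (Γ ∪ₛ ｛ ∃ₛ X φ ｝) ｛ γ ｝
  quantE : ∀ {Σ Γ} (X : Vars Σ) (φ : Sen (Σ [ X ])) (γ : Sen Σ) →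
           Ent Σ (Γ ∪ₛ ｛ ∃ₛ X φ ｝) ｛ γ ｝ →
           Ent (Σ [ X ]) ((ιₛ X ⟨$⟩ Γ) ∪ₛ ｛ φ ｝) ｛ trSen (ιₛ X) γ ｝
  substR : ∀ {Σ Γ} (X : Vars Σ) (φ : Sen (Σ [ X ])) (θ : Subst X) →
           Ent Σ Γ ｛ trSen (substₛ θ) φ ｝ → Ent Σ Γ ｛ ∃ₛ X φ ｝

_⊢_ : ∀ {Σ} → SenSet Σ → Sen Σ → Set₂
_⊢_ {Σ} Γ φ = Ent Σ Γ ｛ φ ｝

-- Compactness of ⊢: a derivation is a well-founded tree whose rules have at most countably
-- many premises, so by induction it rests on countably many hypotheses. The one subtlety is
-- that a premise may use hypotheses the rule discharges (Comp_E, Union_E, Star_E, Disj_E,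
-- Neg_I, Quant_I), possibly over an extended signature; its support is then pruned to the
-- part coming from the outer context. Supports are countably branching trees of sentences,
-- enumerable through a surjection ℕ → ℕ × ℕ.
--
-- Failure for ⊨: with a unary symbol f_r for every r : ℕ → Bool, the axioms say that f_r
-- agrees with r on the numerals, that g is Boolean there, that every transition is a
-- successor step, and that for each r, g differs from f_r at some point reachable from 0.
-- Reachable points are numerals, so the restriction of g to the numerals is some r:
-- contradiction. Countably many axioms mention only countably many r, and g defined as the
-- diagonal of those r gives a model.

module Submission where

open import Defs
open import Level using (Level; _⊔_; 0ℓ; Lift) renaming (suc to lsuc)
open import Data.Bool using (Bool; true; false; not)
open import Data.Empty using (⊥)
open import Data.Fin using (Fin; zero; suc)
open import Data.List using (List; []; _∷_)
open import Data.List.Membership.Propositional using (_∈_)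
open import Data.List.Relation.Unary.Any using (here; there)
open import Data.List.Relation.Unary.All using (All; []; _∷_)
open import Data.Maybe using (Maybe; just; nothing)
open import Data.Nat using (ℕ; zero; suc; _+_)
open import Data.Nat.Properties using (+-suc; +-identityʳ; _≟_)
open import Data.Product using (∃; _×_; _,_; proj₁; uncurry)
open import Data.Sum using (inj₁; inj₂)
open import Data.Unit using (⊤; tt)
open import Function using (_∘_; id; const)
open import Relation.Nullary using (¬_; yes; no)
open import Relation.Binary.PropositionalEquality using (_≡_; _≢_; refl; sym; trans; cong; subst)

-- ω₁-compactness of ⊢

-- Cantor's enumeration of ℕ × ℕ, one anti-diagonal at a time.
next : ℕ × ℕ → ℕ × ℕ
next (zero  , j) = suc j , 0
next (suc i , j) = i , suc j

unpair : ℕ → ℕ × ℕ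
unpair zero    = 0 , 0
unpair (suc n) = next (unpair n)

unpair-walk : ∀ k i n → unpair n ≡ (k + i , 0) → unpair (k + n) ≡ (i , k)
unpair-walk zero    i n p = p
unpair-walk (suc k) i n p =
  cong next (unpair-walk k (suc i) n (trans p (cong (_, 0) (sym (+-suc k i)))))

unpair-diagonal : ∀ d → ∃ λ n → unpair n ≡ (d , 0)
unpair-diagonal zero    = 0 , refl
unpair-diagonal (suc d) with unpair-diagonal d
... | n , p = suc (d + n) , cong next (unpair-walk d 0 n (trans p (cong (_, 0) (sym (+-identityʳ d)))))

unpair-surjective : ∀ i j → ∃ λ n → unpair n ≡ (i , j)
unpair-surjective i j with unpair-diagonal (j + i)
... | n , p = j + n , unpair-walk j i n p

module _ {Σ : Sig} where

  ⊆-refl : {Γ : SenSet Σ} → Γ ⊆ₛ Γ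
  ⊆-refl _ γ = γ

  ⊆-trans : {Γ Δ Θ : SenSet Σ} → Γ ⊆ₛ Δ → Δ ⊆ₛ Θ → Γ ⊆ₛ Θ
  ⊆-trans Γ⊆Δ Δ⊆Θ φ γ = Δ⊆Θ φ (Γ⊆Δ φ γ)

  ∪-monoˡ : {Γ Δ Ξ : SenSet Σ} → Γ ⊆ₛ Δ → (Γ ∪ₛ Ξ) ⊆ₛ (Δ ∪ₛ Ξ)
  ∪-monoˡ Γ⊆Δ φ (inj₁ γ) = inj₁ (Γ⊆Δ φ γ)
  ∪-monoˡ Γ⊆Δ φ (inj₂ r) = inj₂ r

  ∪-least : {Γ Δ Θ : SenSet Σ} → Γ ⊆ₛ Θ → Δ ⊆ₛ Θ → (Γ ∪ₛ Δ) ⊆ₛ Θ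
  ∪-least Γ⊆Θ Δ⊆Θ φ (inj₁ γ) = Γ⊆Θ φ γ
  ∪-least Γ⊆Θ Δ⊆Θ φ (inj₂ δ) = Δ⊆Θ φ δ

  singleton⊆ : {Γ : SenSet Σ} {φ : Sen Σ} → Γ φ → ｛ φ ｝ ⊆ₛ Γ
  singleton⊆ γ _ refl = γ

  weaken : {Γ Δ Φ : SenSet Σ} → Γ ⊆ₛ Δ → Ent Σ Γ Φ → Ent Σ Δ Φ
  weaken Γ⊆Δ = transitivity (monotonicity Γ⊆Δ)

data Tree (Σ : Sig) : Set₁ where
  ∅    : Tree Σ
  leaf : Sen Σ → Tree Σ
  ⋃    : (ℕ → Tree Σ) → Tree Σ

⟦_⟧ : ∀ {Σ} → Tree Σ → SenSet Σ
⟦ ∅ ⟧      _ = Lift _ ⊥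
⟦ leaf ψ ⟧ φ = φ ≡ ψ
⟦ ⋃ ts ⟧   φ = ∃ λ n → ⟦ ts n ⟧ φ

_∪ᵗ_ : ∀ {Σ} → Tree Σ → Tree Σ → Tree Σ
t ∪ᵗ u = ⋃ λ { zero → t ; (suc _) → u }

enumerate : ∀ {Σ} → Tree Σ → ℕ → Maybe (Sen Σ)
enumerate ∅        _ = nothing
enumerate (leaf φ) _ = just φ
enumerate (⋃ ts)   n = uncurry (λ i → enumerate (ts i)) (unpair n)

enumerate-complete : ∀ {Σ} (t : Tree Σ) φ → ⟦ t ⟧ φ → ∃ λ n → enumerate t n ≡ just φ
enumerate-complete (leaf φ) φ refl = 0 , refl
enumerate-complete (⋃ ts) φ (i , φ∈) with enumerate-complete (ts i) φ φ∈
... | j , eq with unpair-surjective i j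
...   | n , n↦ij = n , trans (cong (uncurry λ i → enumerate (ts i)) n↦ij) eq

enumerate-sound : ∀ {Σ} (t : Tree Σ) n φ → enumerate t n ≡ just φ → ⟦ t ⟧ φ
enumerate-sound (leaf φ) n φ refl = refl
enumerate-sound (⋃ ts)   n φ eq   = proj₁ (unpair n) , enumerate-sound (ts _) _ φ eq

⟦⟧-countable : ∀ {Σ} (t : Tree Σ) → AtMostCountable ⟦ t ⟧
⟦⟧-countable t = enumerate t , enumerate-complete t , enumerate-sound t

-- Requiring P of every superset of the support lets supports be merged freely.
record Supported {Σ : Sig} {ℓ : Level} (Γ : SenSet Σ) (P : SenSet Σ → Set ℓ) :
                 Set (lsuc (lsuc (lsuc 0ℓ)) ⊔ ℓ) where
  constructor supported
  field
    support   : Tree Σ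
    support⊆Γ : ⟦ support ⟧ ⊆ₛ Γ
    holds     : ∀ {Δ} → ⟦ support ⟧ ⊆ₛ Δ → P Δ

module _ {Σ : Sig} {Γ : SenSet Σ} where

  unconditionally : ∀ {ℓ} {P : SenSet Σ → Set ℓ} → (∀ {Δ} → P Δ) → Supported Γ P
  unconditionally p = supported ∅ (λ _ ()) (λ _ → p)

  member : ∀ {φ} → Γ φ → Supported Γ (λ Δ → Δ φ)
  member γ = supported (leaf _) (singleton⊆ γ) (λ ⊆Δ → ⊆Δ _ refl)

  map : ∀ {ℓ ℓ'} {P : SenSet Σ → Set ℓ} {Q : SenSet Σ → Set ℓ'} →
        (∀ {Δ} → P Δ → Q Δ) → Supported Γ P → Supported Γ Q
  map P⇒Q (supported t t⊆Γ holds) = supported t t⊆Γ (P⇒Q ∘ holds)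

  widen : ∀ {ℓ} {P : SenSet Σ → Set ℓ} {Γ' : SenSet Σ} → Γ ⊆ₛ Γ' → Supported Γ P → Supported Γ' P
  widen Γ⊆Γ' (supported t t⊆Γ holds) = supported t (⊆-trans t⊆Γ Γ⊆Γ') holds

  both : ∀ {ℓ ℓ'} {P : SenSet Σ → Set ℓ} {Q : SenSet Σ → Set ℓ'} →
         Supported Γ P → Supported Γ Q → Supported Γ (λ Δ → P Δ × Q Δ)
  both (supported t t⊆Γ p) (supported u u⊆Γ q) =
    supported (t ∪ᵗ u) ⊆Γ (λ ⊆Δ → p (λ φ m → ⊆Δ φ (0 , m)) , q (λ φ m → ⊆Δ φ (1 , m)))
    where
    ⊆Γ : ⟦ t ∪ᵗ u ⟧ ⊆ₛ Γ
    ⊆Γ φ (zero  , m) = t⊆Γ φ m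
    ⊆Γ φ (suc _ , m) = u⊆Γ φ m

  all-ℕ : ∀ {ℓ} {P : ℕ → SenSet Σ → Set ℓ} →
          (∀ n → Supported Γ (P n)) → Supported Γ (λ Δ → ∀ n → P n Δ)
  all-ℕ s = supported (⋃ (support ∘ s)) (λ φ (n , m) → support⊆Γ (s n) φ m)
                      (λ ⊆Δ n → holds (s n) (λ φ m → ⊆Δ φ (n , m)))
    where open Supported

  all-∈ : ∀ {a ℓ} {A : Set a} (xs : List A) {P : ∀ {x} → x ∈ xs → SenSet Σ → Set ℓ} →
          (∀ {x} (k : x ∈ xs) → Supported Γ (P k)) → Supported Γ (λ Δ → ∀ {x} (k : x ∈ xs) → P k Δ)
  all-∈ []       _ = unconditionally λ ()
  all-∈ (x ∷ xs) s = map (λ (p , q) → λ { (here refl) → p ; (there k) → q k })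
                         (both (s (here refl)) (all-∈ xs (s ∘ there)))

  all-⟦⟧ : ∀ {ℓ} (t : Tree Σ) {P : Sen Σ → SenSet Σ → Set ℓ} →
           (∀ φ → ⟦ t ⟧ φ → Supported Γ (P φ)) → Supported Γ (λ Δ → ∀ φ → ⟦ t ⟧ φ → P φ Δ)
  all-⟦⟧ ∅        _ = unconditionally λ _ ()
  all-⟦⟧ (leaf ψ) s = map (λ p → λ { _ refl → p }) (s ψ refl)
  all-⟦⟧ (⋃ ts)   s = map (λ p φ (n , m) → p n φ m) (all-ℕ λ n → all-⟦⟧ (ts n) λ φ m → s φ (n , m))

discharge : ∀ {Σ} {Γ : SenSet Σ} {φ ψ : Sen Σ} →
            Supported Γ (λ Δ → (Δ ∪ₛ ｛ φ ｝) ⊢ ψ) → Supported (Γ ∪ₛ ｛ φ ｝) (_⊢ ψ)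
discharge s = map (λ (Δ,φ⊢ψ , φ∈Δ) → weaken (∪-least ⊆-refl (singleton⊆ φ∈Δ)) Δ,φ⊢ψ)
                  (both (widen (λ _ → inj₁) s) (member (inj₂ refl)))

image : ∀ {Σ Σ'} → (Sen Σ → Sen Σ') → SenSet Σ → SenSet Σ'
image h Γ ψ' = ∃ λ ψ → Γ ψ × h ψ ≡ ψ'

image-mono : ∀ {Σ Σ'} (h : Sen Σ → Sen Σ') {Γ Δ : SenSet Σ} → Γ ⊆ₛ Δ → image h Γ ⊆ₛ image h Δ
image-mono h Γ⊆Δ _ (ψ , γ , eq) = ψ , Γ⊆Δ ψ γ , eq

module _ {Σ Σ' : Sig} (h : Sen Σ → Sen Σ') {Γ : SenSet Σ} {Ξ : SenSet Σ'} where

  prune : (t : Tree Σ') → ⟦ t ⟧ ⊆ₛ (image h Γ ∪ₛ Ξ) → Tree Σ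
  prune ∅        _   = ∅
  prune (leaf ψ) t⊆  with t⊆ ψ refl
  ... | inj₁ (ψ₀ , _ , _) = leaf ψ₀
  ... | inj₂ _            = ∅
  prune (⋃ ts)   t⊆  = ⋃ λ n → prune (ts n) (λ φ m → t⊆ φ (n , m))

  prune⊆Γ : (t : Tree Σ') (t⊆ : ⟦ t ⟧ ⊆ₛ (image h Γ ∪ₛ Ξ)) → ⟦ prune t t⊆ ⟧ ⊆ₛ Γ
  prune⊆Γ (leaf ψ) t⊆ with t⊆ ψ refl
  ... | inj₁ (ψ₀ , γ , _) = singleton⊆ γ
  prune⊆Γ (⋃ ts)   t⊆ φ (n , m) = prune⊆Γ (ts n) _ φ m

  covered-by-prune : (t : Tree Σ') (t⊆ : ⟦ t ⟧ ⊆ₛ (image h Γ ∪ₛ Ξ)) →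
                     ⟦ t ⟧ ⊆ₛ (image h ⟦ prune t t⊆ ⟧ ∪ₛ Ξ)
  covered-by-prune (leaf ψ) t⊆ φ refl with t⊆ ψ refl
  ... | inj₁ (ψ₀ , _ , eq) = inj₁ (ψ₀ , refl , eq)
  ... | inj₂ r             = inj₂ r
  covered-by-prune (⋃ ts)   t⊆ φ (n , m) =
    ∪-monoˡ {Ξ = Ξ} (image-mono h λ _ → n ,_) φ (covered-by-prune (ts n) _ φ m)

  pull : ∀ {ℓ} {P : SenSet Σ' → Set ℓ} →
         Supported (image h Γ ∪ₛ Ξ) P → Supported Γ (λ Δ → P (image h Δ ∪ₛ Ξ))
  pull (supported t t⊆ holds) =
    supported (prune t t⊆) (prune⊆Γ t t⊆)
              (λ ⊆Δ → holds (⊆-trans (covered-by-prune t t⊆) (∪-monoˡ {Ξ = Ξ} (image-mono h ⊆Δ))))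

pull-id : ∀ {Σ ℓ} {Γ Ξ : SenSet Σ} {P : SenSet Σ → Set ℓ} →
          Supported (Γ ∪ₛ Ξ) P → Supported Γ (λ Δ → P (Δ ∪ₛ Ξ))
pull-id {Ξ = Ξ} (supported t t⊆ holds) =
  supported (prune id t t⊆′) (prune⊆Γ id t t⊆′)
            (λ ⊆Δ → holds (⊆-trans (covered-by-prune id t t⊆′)
                                   (∪-monoˡ {Ξ = Ξ} λ { _ (ψ , m , refl) → ⊆Δ ψ m })))
  where
  t⊆′ = ⊆-trans t⊆ (∪-monoˡ {Ξ = Ξ} λ φ γ → φ , γ , refl)

mapTree : ∀ {Σ Σ'} → (Sen Σ → Sen Σ') → Tree Σ → Tree Σ'
mapTree h ∅        = ∅
mapTree h (leaf φ) = leaf (h φ)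
mapTree h (⋃ ts)   = ⋃ (mapTree h ∘ ts)

mapTree⊆image : ∀ {Σ Σ'} (h : Sen Σ → Sen Σ') (t : Tree Σ) → ⟦ mapTree h t ⟧ ⊆ₛ image h ⟦ t ⟧
mapTree⊆image h (leaf φ) _ refl      = φ , refl , refl
mapTree⊆image h (⋃ ts)   φ (n , m) = image-mono h (λ _ → n ,_) φ (mapTree⊆image h (ts n) φ m)

image⊆mapTree : ∀ {Σ Σ'} (h : Sen Σ → Sen Σ') (t : Tree Σ) → image h ⟦ t ⟧ ⊆ₛ ⟦ mapTree h t ⟧
image⊆mapTree h (leaf φ) _ (_ , refl , refl) = refl
image⊆mapTree h (⋃ ts)   _ (ψ , (n , m) , eq) = n , image⊆mapTree h (ts n) _ (ψ , m , eq)

push : ∀ {Σ Σ' ℓ ℓ'} (h : Sen Σ → Sen Σ') {Γ : SenSet Σ}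
       {P : SenSet Σ → Set ℓ} {Q : SenSet Σ' → Set ℓ'} →
       (∀ {Δ Δ'} → image h Δ ⊆ₛ Δ' → P Δ → Q Δ') → Supported Γ P → Supported (image h Γ) Q
push h transfer (supported t t⊆Γ holds) =
  supported (mapTree h t) (⊆-trans (mapTree⊆image h t) (image-mono h t⊆Γ))
            (λ ⊆Δ' → transfer (⊆-trans (image⊆mapTree h t) ⊆Δ') (holds ⊆-refl))

compact : ∀ {Σ} {Γ Φ : SenSet Σ} → Ent Σ Γ Φ → ∀ φ → Φ φ → Supported Γ (_⊢ φ)

compact-⊢ : ∀ {Σ} {Γ : SenSet Σ} {φ : Sen Σ} → Γ ⊢ φ → Supported Γ (_⊢ φ)
compact-⊢ Γ⊢φ = compact Γ⊢φ _ refl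

compact (monotonicity Φ⊆Γ) φ φ∈Φ = map (monotonicity ∘ singleton⊆) (member (Φ⊆Γ φ φ∈Φ))
compact (transitivity Γ⊢Φ Φ⊢Ψ) ψ ψ∈Ψ with compact Φ⊢Ψ ψ ψ∈Ψ
... | supported t t⊆Φ t⊢ψ =
  map (λ Δ⊢t → transitivity (union Δ⊢t) (t⊢ψ ⊆-refl))
      (all-⟦⟧ t λ φ φ∈t → compact Γ⊢Φ φ (t⊆Φ φ φ∈t))
compact (union Γ⊢Φ) φ φ∈Φ = compact-⊢ (Γ⊢Φ φ φ∈Φ)
compact (translation χ Γ⊢Φ) _ (ψ , ψ∈Φ , refl) = push (trSen (toS χ)) transfer (compact Γ⊢Φ ψ ψ∈Φ)
  where
  transfer : ∀ {Δ Δ'} → image (trSen (toS χ)) Δ ⊆ₛ Δ' → Δ ⊢ ψ → Δ' ⊢ trSen (toS χ) ψ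
  transfer χΔ⊆Δ' Δ⊢ψ =
    weaken χΔ⊆Δ' (transitivity (translation χ Δ⊢ψ) (monotonicity λ { _ refl → ψ , refl , refl }))
compact (R t) _ refl = unconditionally (R t)
compact (S d) _ refl = map S (compact-⊢ d)
compact (T d₁ d₂) _ refl = map (uncurry T) (both (compact-⊢ d₁) (compact-⊢ d₂))
compact (F f ts us ds) _ refl = map (F f ts us) (all-∈ _ λ k → compact-⊢ (ds k))
compact (P d₁ d₂ d₃) _ refl =
  map (λ (e₁ , e₂ , e₃) → P e₁ e₂ e₃) (both (compact-⊢ d₁) (both (compact-⊢ d₂) (compact-⊢ d₃)))
compact (M f m k ts u d) _ refl = map (M f m k ts u) (compact-⊢ d)
compact (compI d₁ d₂) _ refl = map (uncurry compI) (both (compact-⊢ d₁) (compact-⊢ d₂))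
compact (compE {s = s} d₁ d₂) _ refl =
  map (uncurry compE) (both (compact-⊢ d₁) (pull (trSen (ιₛ ⟨ s ⟩)) (compact-⊢ d₂)))
compact (unionI₁ d) _ refl = map unionI₁ (compact-⊢ d)
compact (unionI₂ d) _ refl = map unionI₂ (compact-⊢ d)
compact (unionE d₁ d₂ d₃) _ refl =
  map (λ (e₁ , e₂ , e₃) → unionE e₁ e₂ e₃)
      (both (compact-⊢ d₁) (both (pull-id (compact-⊢ d₂)) (pull-id (compact-⊢ d₃))))
compact (starI n d) _ refl = map (starI n) (compact-⊢ d)
compact (starE d ds) _ refl =
  map (uncurry starE) (both (compact-⊢ d) (all-ℕ λ n → pull-id (compact-⊢ (ds n))))
compact (negD d) _ refl = map negD (compact-⊢ d)
compact (false d) _ refl = map false (compact-⊢ d)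
compact (negI d) _ refl = map negI (pull-id (compact-⊢ d))
compact (negE d) _ refl = discharge (map negE (compact-⊢ d))
compact (disjI φ∈Φ d) _ refl = map (disjI φ∈Φ) (compact-⊢ d)
compact (disjE d ds) _ refl =
  map (λ (e , es) → disjE e λ _ φ∈Φ → es φ∈Φ)
      (both (compact-⊢ d) (all-∈ _ λ φ∈Φ → pull-id (compact-⊢ (ds _ φ∈Φ))))
compact (quantI X φ γ d) _ refl = discharge (map (quantI X φ γ) (pull (trSen (ιₛ X)) (compact-⊢ d)))
compact (quantE X φ γ d) _ refl = discharge (push (trSen (ιₛ X)) transfer (pull-id (compact-⊢ d)))
  where
  transfer : ∀ {Δ Δ'} → image (trSen (ιₛ X)) Δ ⊆ₛ Δ' →
             (Δ ∪ₛ ｛ ∃ₛ X φ ｝) ⊢ γ → (Δ' ∪ₛ ｛ φ ｝) ⊢ trSen (ιₛ X) γ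
  transfer ιΔ⊆Δ' d′ = weaken (∪-monoˡ ιΔ⊆Δ') (quantE X φ γ d′)
compact (substR X φ θ d) _ refl = map (substR X φ θ) (compact-⊢ d)

⊢-countably-compact : (Σ : Sig) (Γ : SenSet Σ) (φ : Sen Σ) → Γ ⊢ φ →
                      ∃ λ (Γ₀ : SenSet Σ) → Γ₀ ⊆ₛ Γ × AtMostCountable Γ₀ × Γ₀ ⊢ φ
⊢-countably-compact Σ Γ φ Γ⊢φ with compact-⊢ Γ⊢φ
... | supported t t⊆Γ holds = ⟦ t ⟧ , t⊆Γ , ⟦⟧-countable t , holds ⊆-refl

-- ⊨ is not ω₁-compact

_⊃_ : ∀ {Σ} → Sen Σ → Sen Σ → Sen Σ
φ ⊃ ψ = ⋁ (¬ₛ φ ∷ ψ ∷ [])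

∀ₛ : ∀ {Σ} (X : Vars Σ) → Sen (Σ [ X ]) → Sen Σ
∀ₛ X φ = ¬ₛ ∃ₛ X (¬ₛ φ)

data Op : List ⊤ → ⊤ → Set where
  zero′ true′ false′ : Op [] tt
  suc′ g : Op (tt ∷ []) tt
  f : (ℕ → Bool) → Op (tt ∷ []) tt

Σ₀ : Sig
Σ₀ = record { Sort = ⊤ ; Fun = Op ; Mono = λ _ → ⊥ ; Lab = ⊤ }

infixr 25 _∙_

_∙_ : Op (tt ∷ []) tt → Term Σ₀ tt → Term Σ₀ tt
o ∙ t = app o (t ∷ₜ []ₜ)

numeral : ℕ → Term Σ₀ tt
numeral zero    = app zero′ []ₜ
numeral (suc n) = suc′ ∙ numeral n

boolean : Bool → Term Σ₀ tt
boolean true  = app true′ []ₜ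
boolean false = app false′ []ₜ

module _ {X : Vars Σ₀} where

  infixr 25 _∙ˣ_

  _∙ˣ_ : Op (tt ∷ []) tt → Term (Σ₀ [ X ]) tt → Term (Σ₀ [ X ]) tt
  o ∙ˣ t = app (old o) (t ∷ₜ []ₜ)

  zeroˣ : Term (Σ₀ [ X ]) tt
  zeroˣ = app (old zero′) []ₜ

  x : Fin (size X) → Term (Σ₀ [ X ]) tt
  x i = app (var i) []ₜ

one two : Vars Σ₀
one = vars 1 _
two = vars 2 _

f-value : (ℕ → Bool) → ℕ → Sen Σ₀
f-value r n = f r ∙ numeral n ≐ boolean (r n)

g-boolean : ℕ → Sen Σ₀
g-boolean n = ⋁ ((g ∙ numeral n ≐ boolean true) ∷ (g ∙ numeral n ≐ boolean false) ∷ [])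

steps-are-successors : Sen Σ₀
steps-are-successors = ∀ₛ two ((x zero ⇒⟨ lab tt ⟩ x (suc zero)) ⊃ (x (suc zero) ≐ suc′ ∙ˣ x zero))

g-differs-from : (ℕ → Bool) → Sen Σ₀
g-differs-from r = ∃ₛ one (¬ₛ ((zeroˣ ⇒⟨ lab tt ⋆ ⟩ x zero) ⊃ (g ∙ˣ x zero ≐ f r ∙ˣ x zero)))

data Axiom : Sen Σ₀ → Set₁ where
  differs    : ∀ r → Axiom (g-differs-from r)
  value      : ∀ r n → Axiom (f-value r n)
  successors : Axiom steps-are-successors
  boolean-g  : ∀ n → Axiom (g-boolean n)

-- Sentences have no decidable equality, so r is read back from the syntax of
-- g-differs-from r; other sentences get an arbitrary label.
label : Maybe (Sen Σ₀) → ℕ → Bool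
label (just (∃ₛ _ (¬ₛ ⋁ (_ ∷ (_ ≐ app (old (f r)) _) ∷ _)))) = r
label _ = const false

module _ (A : Model Σ₀) (A⊨ : ∀ ψ → Axiom ψ → A ⊨ₛ ψ) where

  IsNumeral : car A tt → Set
  IsNumeral a = ∃ λ m → a ≡ evalT A (numeral m)

  step-preserves-numeral : ∀ {a c} → IsNumeral a → rel A tt tt a c → ¬ ¬ IsNumeral c
  step-preserves-numeral {a} {c} (m , refl) a→c ¬num = A⊨ _ successors (v , λ
    { (inj₁ ¬a→c)        → ¬a→c a→c
    ; (inj₂ (inj₁ c≡sa)) → ¬num (suc m , c≡sa)
    ; (inj₂ (inj₂ ())) })
    where
    v : Fin 2 → car A tt
    v zero    = a
    v (suc _) = c

  steps-preserve-numeral : ∀ k {a c} → IsNumeral a → Iter (rel A tt tt) k a c → ¬ ¬ IsNumeral c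
  steps-preserve-numeral zero    num refl ¬num = ¬num num
  steps-preserve-numeral (suc k) num (b , a→b , b→*c) ¬num =
    step-preserves-numeral num a→b λ numb → steps-preserve-numeral k numb b→*c ¬num

  g-bit : ℕ → Bool
  g-bit n with A⊨ _ (boolean-g n)
  ... | inj₁ _ = true
  ... | inj₂ _ = false

  g-numeral : ∀ n → fun A g (evalT A (numeral n) ∷ []) ≡ evalT A (boolean (g-bit n))
  g-numeral n with A⊨ _ (boolean-g n)
  ... | inj₁ eq        = eq
  ... | inj₂ (inj₁ eq) = eq

  g-agrees-with-f : ∀ {a} → IsNumeral a → fun A g (a ∷ []) ≡ fun A (f g-bit) (a ∷ [])
  g-agrees-with-f (m , refl) = trans (g-numeral m) (sym (A⊨ _ (value g-bit m)))

  axioms-inconsistent : ⊥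
  axioms-inconsistent with A⊨ _ (differs g-bit)
  ... | v , ¬[reachable⊃agrees] = ¬[reachable⊃agrees] (inj₁ λ (k , 0→*v) →
    steps-preserve-numeral k (0 , refl) 0→*v λ num →
      ¬[reachable⊃agrees] (inj₂ (inj₁ (g-agrees-with-f num))))

Axiom⊨⊥ : Axiom ⊨ ⊥ₛ
Axiom⊨⊥ A A⊨ = axioms-inconsistent A A⊨

bit : Bool → ℕ
bit true  = 1
bit false = 0

bit-not : ∀ b → bit (not b) ≢ bit b
bit-not true  ()
bit-not false ()

Successor : ℕ → ℕ → Set
Successor a c = c ≡ suc a

successor-path : ∀ n j → Iter Successor n j (n + j)
successor-path zero    j = refl
successor-path (suc n) j =
  suc j , refl , subst (Iter Successor n (suc j)) (+-suc n j) (successor-path n (suc j))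

module _ (e : ℕ → Maybe (Sen Σ₀)) where

  diagonal : ℕ → Bool
  diagonal m = not (label (e m) m)

  interp : ∀ {w s} → Op w s → All (λ _ → ℕ) w → ℕ
  interp zero′  []      = 0
  interp true′  []      = bit true
  interp false′ []      = bit false
  interp suc′   (m ∷ []) = suc m
  interp g      (m ∷ []) = bit (diagonal m)
  interp (f r)  (m ∷ []) = bit (r m)

  diagonal-model : Model Σ₀
  diagonal-model = record
    { car = λ _ → ℕ ; fun = interp ; rel = λ _ _ → Successor ; mono = λ _ () }

  numeral-value : ∀ n → evalT diagonal-model (numeral n) ≡ n
  numeral-value zero    = refl
  numeral-value (suc n) = cong suc (numeral-value n)

  boolean-value : ∀ b → evalT diagonal-model (boolean b) ≡ bit b
  boolean-value true  = refl
  boolean-value false = refl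

  diagonal-avoids : ∀ {n r} → e n ≡ just (g-differs-from r) → bit (diagonal n) ≢ bit (r n)
  diagonal-avoids {n} {r} eₙ rewrite eₙ = bit-not (r n)

  diagonal-model-⊨ : ∀ {ψ} → Axiom ψ → (∃ λ n → e n ≡ just ψ) → diagonal-model ⊨ₛ ψ
  diagonal-model-⊨ (differs r) (n , eₙ) = (λ _ → n) , λ
    { (inj₁ ¬0→*n) → ¬0→*n (n , subst (Iter Successor n 0) (+-identityʳ n) (successor-path n 0))
    ; (inj₂ (inj₁ g≡f)) → diagonal-avoids eₙ g≡f
    ; (inj₂ (inj₂ ())) }
  diagonal-model-⊨ (value r n) _ = trans (cong (bit ∘ r) (numeral-value n)) (sym (boolean-value (r n)))
  diagonal-model-⊨ successors _ (v , ¬[step⊃suc]) with v (suc zero) ≟ suc (v zero)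
  ... | yes eq = ¬[step⊃suc] (inj₂ (inj₁ eq))
  ... | no ¬eq = ¬[step⊃suc] (inj₁ ¬eq)
  diagonal-model-⊨ (boolean-g n) _ with diagonal (evalT diagonal-model (numeral n))
  ... | true  = inj₁ refl
  ... | false = inj₂ (inj₁ refl)

⊨-not-countably-compact :
  ∃ λ (Σ : Sig) → ∃ λ (Γ : SenSet Σ) → ∃ λ (φ : Sen Σ) →
    Γ ⊨ φ × ((Γ₀ : SenSet Σ) → Γ₀ ⊆ₛ Γ → AtMostCountable Γ₀ → ¬ (Γ₀ ⊨ φ))
⊨-not-countably-compact = Σ₀ , Axiom , ⊥ₛ , Axiom⊨⊥ , λ Γ₀ Γ₀⊆ (e , enumerated , _) Γ₀⊨⊥ →
  Γ₀⊨⊥ (diagonal-model e) λ ψ ψ∈Γ₀ → diagonal-model-⊨ e (Γ₀⊆ ψ ψ∈Γ₀) (enumerated ψ ψ∈Γ₀)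

proposition3p9 : ((Σ : Sig) (Γ : SenSet Σ) (φ : Sen Σ) → Γ ⊢ φ →
    ∃ λ (Γ₀ : SenSet Σ) → Γ₀ ⊆ₛ Γ × AtMostCountable Γ₀ × Γ₀ ⊢ φ)
    ×
    (∃ λ (Σ : Sig) → ∃ λ (Γ : SenSet Σ) → ∃ λ (φ : Sen Σ) →
    Γ ⊨ φ × ((Γ₀ : SenSet Σ) → Γ₀ ⊆ₛ Γ → AtMostCountable Γ₀ → ¬ (Γ₀ ⊨ φ)))
proposition3p9 = ⊢-countably-compact , ⊨-not-countably-compact
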